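{- Let $s$ be a nonzero integer and consider the cyclic system of $n$ simultaneous congruences $$ \frac{\prod_{k=1}^n q_k}{q_i} \equiv s \pmod{|q_i|}, \qquad 1 \le i \le n. $$ (1) For each $n \ge 2$ this system has infinitely many integer solutions $(q_1, \dots, q_n) \in (\mathbb{Z}\setminus\{0\})^n$ with at least two indices $i$ having $|q_i| \ge 2$ and with $\gcd(q_1 q_2 \cdots q_n, s) = 1$. (2) For each $n \ge 2$ there exists an integer $M_n^{\ast}$ such that whenever $\gcd(s, M_n^{\ast}) = 1$, this system has infinitely many integer solutions $(q_1,\dots,q_n)\in(\mathbb{Z}\setminus\{0\})^n$ satisfying $\gcd(q_1 q_2 \cdots q_n, s) = 1$ and $\min_i\{|q_i|\} \ge 2$. An allowable value is $M_n^{\ast} = u_1 u_2 \cdots u_n$, where $u_i$ are the terms of Sylvester's sequence.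
   Context: Sylvester's sequence is defined by $u_0 = 1$ and $u_{n+1} = \left(\prod_{i=1}^{n} u_i\right) + 1$ for $n\ge 0$, i.e. $u_1=2, u_2=3, u_3=7, u_4=43, u_5=1807, \dots$ (equivalently $u_1=2$ and $u_{n+1}=\prod_{i=1}^n u_i+1$). -}

module Defs where

open import Data.Nat as ℕ using (ℕ; zero; suc)
open import Data.Integer using (ℤ; +_; _*_; _-_; ∣_∣; 1ℤ; 0ℤ)
open import Data.Integer.Divisibility using (_∣_)
open import Data.Integer.GCD using (gcd)
open import Data.Fin using (Fin; zero; suc)
open import Data.Vec using (Vec; []; _∷_; lookup)
open import Data.List using (List)
open import Data.List.Membership.Propositional using (_∉_)
open import Data.Product using (Σ; _×_; ∃-syntax)
open import Relation.Binary.PropositionalEquality using (_≡_; _≢_)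

-- Sylvester's sequence u_0 = 1, u_{n+1} = (∏_{i=1}^n u_i) + 1,
-- together with sylProd n = u_1 u_2 ⋯ u_n (empty product = 1 for n = 0).
mutual
  syl : ℕ → ℕ
  syl zero    = 1
  syl (suc n) = sylProd n ℕ.+ 1

  sylProd : ℕ → ℕ
  sylProd zero    = 1
  sylProd (suc n) = sylProd n ℕ.* syl (suc n)

prodℤ : ∀ {n} → Vec ℤ n → ℤ
prodℤ []       = 1ℤ
prodℤ (x ∷ xs) = x * prodℤ xs

prodExcept : ∀ {n} → Vec ℤ n → Fin n → ℤ
prodExcept (x ∷ xs) zero    = prodℤ xs
prodExcept (x ∷ xs) (suc i) = x * prodExcept xs i

-- a ≡ b (mod |m|);  note Data.Integer's  m ∣ k  means  |m| divides |k|
_≡_[mod_] : ℤ → ℤ → ℤ → Set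
a ≡ b [mod m ] = m ∣ (a - b)

IsSolution : ∀ {n} → ℤ → Vec ℤ n → Set
IsSolution s q =
  (∀ i → lookup q i ≢ 0ℤ) × (∀ i → prodExcept q i ≡ s [mod lookup q i ])

CoprimeToS : ∀ {n} → ℤ → Vec ℤ n → Set
CoprimeToS s q = gcd (prodℤ q) s ≡ 1ℤ

TwoBig : ∀ {n} → Vec ℤ n → Set
TwoBig q = Σ _ λ i → Σ _ λ j → (i ≢ j) × (2 ℕ.≤ ∣ lookup q i ∣) × (2 ℕ.≤ ∣ lookup q j ∣)

AllBig : ∀ {n} → Vec ℤ n → Set
AllBig q = ∀ i → 2 ℕ.≤ ∣ lookup q i ∣

InfinitelyMany : ∀ {n} → (Vec ℤ n → Set) → Set
InfinitelyMany {n} P = (L : List (Vec ℤ n)) → ∃[ q ] (P q × q ∉ L)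

-- If v solves the system for s = 1, then prepending s − ∏v gives a solution for s, whose
-- product (s − ∏v)·∏v is coprime to s as soon as ∏v is.  For part (1) take v = (a, 1, …, 1).
-- For part (2) take the chain x₀ = a, xₘ₊₁ = 1 − x₀⋯xₘ: for a = −1 its entries are
-- −1, u₁, …, u_k and its product is −u₁⋯u_k.  Choosing a ≡ −1 (mod s) keeps the product
-- ≡ −u₁⋯u_k (mod s), a unit when gcd(s, M*ₙ) = 1, and choosing a very negative makes every
-- entry of size ≥ 2.  Letting a → −∞ gives infinitely many solutions.
module Submission where

open import Defs
open import Data.Nat using (ℕ; _≤_)
open import Data.Integer using (ℤ; +_; 0ℤ; 1ℤ)
open import Data.Integer.GCD using (gcd)
open import Data.Product using (_×_; ∃-syntax)
open import Relation.Binary.PropositionalEquality using (_≡_; _≢_)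

open import Data.Nat as ℕ using (zero; suc; z≤n; s≤s)
import Data.Nat.Properties as ℕ
import Data.Nat.Divisibility as ℕ
open import Data.Nat.Coprimality using (gcd≡1⇒coprime; coprime-Bézout)
open import Data.Nat.GCD using (module Bézout)
open import Data.Nat.ListAction using (sum)
open import Data.Integer using (-[1+_]; +[1+_]; _*_; _+_; _-_; -_; ∣_∣; -1ℤ)
open import Data.Integer.Properties using (*-identityˡ; *-identityʳ; *-assoc; *-comm; pos-*; +-injective; ⊖-≥)
open import Data.Integer.GCD using (gcd-comm; gcd[i,j]∣i; gcd[i,j]∣j)
open import Data.Integer.Divisibility.Signed
  using (_∣_; divides; ∣ᵤ⇒∣; ∣⇒∣ᵤ; m∣∣m∣; ∣m⇒∣-m; ∣m⇒∣m*n; ∣n⇒∣m*n; ∣m∣n⇒∣m+n)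
open import Data.Integer.Tactic.RingSolver using (solve-∀)
open import Data.Fin using (zero; suc; fromℕ)
open import Data.Vec using (Vec; []; _∷_; lookup; replicate)
open import Data.Vec.Properties using (lookup-replicate)
open import Data.List using (List; _∷_; map)
open import Data.List.Membership.Propositional using (_∈_; _∉_)
open import Data.List.Relation.Unary.Any using (here; there)
open import Data.Product using (_,_; proj₁; proj₂)
open import Data.Empty using (⊥-elim)
open import Relation.Binary.PropositionalEquality using (refl; sym; trans; cong; cong₂; subst; module ≡-Reasoning)
open ≡-Reasoning

∈⇒≤sum-map : ∀ {A : Set} (μ : A → ℕ) {x : A} {xs : List A} → x ∈ xs → μ x ≤ sum (map μ xs)
∈⇒≤sum-map μ {xs = y ∷ _}  (here refl) = ℕ.m≤m+n (μ y) _
∈⇒≤sum-map μ {xs = y ∷ ys} (there x∈) = ℕ.≤-trans (∈⇒≤sum-map μ x∈) (ℕ.m≤n+m _ (μ y))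

unbounded⇒fresh : ∀ {A : Set} (P : A → Set) (μ : A → ℕ) (f : ℕ → A) →
                  (∀ t → P (f t)) → (∀ t → t ≤ μ (f t)) →
                  (xs : List A) → ∃[ x ] (P x × x ∉ xs)
unbounded⇒fresh P μ f Pf μf xs = f t , Pf t , λ ft∈xs →
  ℕ.<-irrefl refl (ℕ.<-≤-trans (s≤s (∈⇒≤sum-map μ ft∈xs)) (μf t))
  where t = suc (sum (map μ xs))

UnitMod : ℤ → ℤ → Set
UnitMod s x = ∃[ u ] ∃[ v ] u * x + v * s ≡ 1ℤ

module _ {s : ℤ} where

  unitMod-1 : UnitMod s 1ℤ
  unitMod-1 = 1ℤ , 0ℤ , identity s
    where identity : ∀ s → 1ℤ * 1ℤ + 0ℤ * s ≡ 1ℤ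
          identity = solve-∀

  unitMod-neg : ∀ {x} → UnitMod s x → UnitMod s (- x)
  unitMod-neg {x} (u , v , e) = - u , v , trans (identity u v x s) e
    where identity : ∀ u v x s → (- u) * (- x) + v * s ≡ u * x + v * s
          identity = solve-∀

  unitMod-complement : ∀ {x} → UnitMod s x → UnitMod s (s - x)
  unitMod-complement {x} (u , v , e) = - u , v + u , trans (identity u v x s) e
    where identity : ∀ u v x s → (- u) * (s - x) + (v + u) * s ≡ u * x + v * s
          identity = solve-∀

  unitMod-* : ∀ {x y} → UnitMod s x → UnitMod s y → UnitMod s (x * y)
  unitMod-* {x} {y} (u , v , e) (u′ , v′ , e′) =
    u * u′ , v * (u′ * y + v′ * s) + u * x * v′ , (begin
      u * u′ * (x * y) + (v * (u′ * y + v′ * s) + u * x * v′) * s ≡⟨ identity u v x u′ v′ y s ⟩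
      (u * x + v * s) * (u′ * y + v′ * s)                         ≡⟨ cong₂ _*_ e e′ ⟩
      1ℤ * 1ℤ                                                     ≡⟨⟩
      1ℤ                                                          ∎)
    where
    identity : ∀ u v x u′ v′ y s →
      u * u′ * (x * y) + (v * (u′ * y + v′ * s) + u * x * v′) * s ≡ (u * x + v * s) * (u′ * y + v′ * s)
    identity = solve-∀

  unitMod-divisor : ∀ {x y} → x ∣ y → UnitMod s y → UnitMod s x
  unitMod-divisor {x} (divides c y≡cx) (u , v , e) = u * c , v , (begin
    u * c * x + v * s   ≡⟨ cong (_+ v * s) (*-assoc u c x) ⟩
    u * (c * x) + v * s ≡⟨ cong (λ y → u * y + v * s) (sym y≡cx) ⟩
    _                   ≡⟨ e ⟩
    1ℤ                  ∎)

  unitMod-cong : ∀ {x y} → s ∣ x - y → UnitMod s y → UnitMod s x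
  unitMod-cong {x} {y} (divides k x-y≡ks) (u , v , e) = u , v - u * k , (begin
    u * x + (v - u * k) * s               ≡⟨ split u v k x y s ⟩
    u * y + v * s + u * (x - y - k * s)   ≡⟨ cong (λ d → u * y + v * s + u * (d - k * s)) x-y≡ks ⟩
    u * y + v * s + u * (k * s - k * s)   ≡⟨ cancel u v k y s ⟩
    u * y + v * s                         ≡⟨ e ⟩
    1ℤ                                    ∎)
    where
    split : ∀ u v k x y s → u * x + (v - u * k) * s ≡ u * y + v * s + u * (x - y - k * s)
    split = solve-∀
    cancel : ∀ u v k y s → u * y + v * s + u * (k * s - k * s) ≡ u * y + v * s
    cancel = solve-∀

unitMod-modulus : ∀ {s m x} → s ∣ m → UnitMod m x → UnitMod s x
unitMod-modulus {s} {m} {x} (divides c m≡cs) (u , v , e) = u , v * c , (begin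
  u * x + v * c * s   ≡⟨ cong (λ n → u * x + n) (*-assoc v c s) ⟩
  u * x + v * (c * s) ≡⟨ cong (λ n → u * x + v * n) (sym m≡cs) ⟩
  u * x + v * m       ≡⟨ e ⟩
  1ℤ                  ∎)

unitMod⇒gcd≡1 : ∀ {s x} → UnitMod s x → gcd x s ≡ 1ℤ
unitMod⇒gcd≡1 {s} {x} (u , v , e) = cong +_ (ℕ.∣1⇒≡1 (∣⇒∣ᵤ g∣1))
  where
  g∣1 : gcd x s ∣ 1ℤ
  g∣1 = subst (gcd x s ∣_) e
    (∣m∣n⇒∣m+n (∣n⇒∣m*n u (∣ᵤ⇒∣ (gcd[i,j]∣i x s))) (∣n⇒∣m*n v (∣ᵤ⇒∣ (gcd[i,j]∣j x s))))

pos-1+ab : ∀ {a b c d} → 1 ℕ.+ a ℕ.* b ≡ c ℕ.* d → + c * + d ≡ 1ℤ + + a * + b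
pos-1+ab {a} {b} {c} {d} eq =
  trans (sym (pos-* c d)) (trans (cong +_ (sym eq)) (cong (λ n → 1ℤ + n) (pos-* a b)))

bézout⇒unitMod : ∀ {m n} → Bézout.Identity 1 m n → UnitMod (+ n) (+ m)
bézout⇒unitMod {m} {n} (Bézout.+- x y 1+yn≡xm) = + x , - + y , (begin
  + x * + m + (- + y) * + n           ≡⟨ cong (_+ (- + y) * + n) (pos-1+ab {y} {n} {x} {m} 1+yn≡xm) ⟩
  1ℤ + + y * + n + (- + y) * + n      ≡⟨ cancel (+ y) (+ n) ⟩
  1ℤ                                  ∎)
  where
  cancel : ∀ a b → 1ℤ + a * b + (- a) * b ≡ 1ℤ
  cancel = solve-∀
bézout⇒unitMod {m} {n} (Bézout.-+ x y 1+xm≡yn) = - + x , + y , (begin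
  (- + x) * + m + + y * + n           ≡⟨ cong (λ n → (- + x) * + m + n) (pos-1+ab {x} {m} {y} {n} 1+xm≡yn) ⟩
  (- + x) * + m + (1ℤ + + x * + m)    ≡⟨ cancel (+ x) (+ m) ⟩
  1ℤ                                  ∎)
  where
  cancel : ∀ a b → (- a) * b + (1ℤ + a * b) ≡ 1ℤ
  cancel = solve-∀

gcd≡1⇒unitMod : ∀ {s x} → gcd x s ≡ 1ℤ → UnitMod s x
gcd≡1⇒unitMod {s} {x} gcd≡1 =
  unitMod-divisor m∣∣m∣ (unitMod-modulus m∣∣m∣
    (bézout⇒unitMod (coprime-Bézout (gcd≡1⇒coprime (+-injective gcd≡1)))))

CyclicSolution : ∀ {n} → ℤ → Vec ℤ n → Set
CyclicSolution s q = ∀ i → lookup q i ∣ prodExcept q i - s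

prodℤ≡prodExcept*lookup : ∀ {n} (v : Vec ℤ n) i → prodℤ v ≡ prodExcept v i * lookup v i
prodℤ≡prodExcept*lookup (x ∷ xs) zero    = *-comm x (prodℤ xs)
prodℤ≡prodExcept*lookup (x ∷ xs) (suc i) =
  trans (cong (x *_) (prodℤ≡prodExcept*lookup xs i)) (sym (*-assoc x (prodExcept xs i) (lookup xs i)))

extend : ∀ {n} → ℤ → Vec ℤ n → Vec ℤ (suc n)
extend s v = (s - prodℤ v) ∷ v

extend-cyclic : ∀ {n} s (v : Vec ℤ n) → CyclicSolution 1ℤ v → CyclicSolution s (extend s v)
extend-cyclic s v _ zero = divides -1ℤ (identity (prodℤ v) s)
  where identity : ∀ p s → p - s ≡ -1ℤ * (s - p)
        identity = solve-∀
extend-cyclic s v cyclic (suc i) with cyclic i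
... | divides k E-1≡kq = divides (s * k - E * E) (begin
  (s - prodℤ v) * E - s    ≡⟨ cong (λ p → (s - p) * E - s) (prodℤ≡prodExcept*lookup v i) ⟩
  (s - E * q) * E - s      ≡⟨ regroup s E q ⟩
  s * (E - 1ℤ) - E * E * q ≡⟨ cong (λ d → s * d - E * E * q) E-1≡kq ⟩
  s * (k * q) - E * E * q  ≡⟨ factor s k E q ⟩
  (s * k - E * E) * q      ∎)
  where
  E = prodExcept v i
  q = lookup v i
  regroup : ∀ s E q → (s - E * q) * E - s ≡ s * (E - 1ℤ) - E * E * q
  regroup = solve-∀
  factor : ∀ s k E q → s * (k * q) - E * E * q ≡ (s * k - E * E) * q
  factor = solve-∀

extend-solution : ∀ {n} s (v : Vec ℤ n) → CyclicSolution 1ℤ v → UnitMod s (prodℤ v) →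
                  (∀ i → lookup (extend s v) i ≢ 0ℤ) →
                  IsSolution s (extend s v) × CoprimeToS s (extend s v)
extend-solution s v cyclic unit nonzero =
  (nonzero , λ i → ∣⇒∣ᵤ (extend-cyclic s v cyclic i)) ,
  unitMod⇒gcd≡1 (unitMod-* (unitMod-complement unit) unit)

2≤∣i∣⇒i≢0 : ∀ {i} → 2 ≤ ∣ i ∣ → i ≢ 0ℤ
2≤∣i∣⇒i≢0 () refl

-[1+j]--1≡-j : ∀ j → -[1+ j ] - -1ℤ ≡ - + j
-[1+j]--1≡-j zero    = refl
-[1+j]--1≡-j (suc j) = refl

-[1+∣s∣*m]≡-1[mod-s] : ∀ s m → s ∣ -[1+ ∣ s ∣ ℕ.* m ] - -1ℤ
-[1+∣s∣*m]≡-1[mod-s] s m =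
  subst (s ∣_) (sym (-[1+j]--1≡-j _)) (∣m⇒∣-m (∣ᵤ⇒∣ {s} {+ (∣ s ∣ ℕ.* m)} (ℕ.m∣m*n m)))

2+t≤∣s∣*[2+t] : ∀ s t → s ≢ 0ℤ → 2 ℕ.+ t ≤ ∣ s ∣ ℕ.* (2 ℕ.+ t)
2+t≤∣s∣*[2+t] (+ zero)   t s≢0 = ⊥-elim (s≢0 refl)
2+t≤∣s∣*[2+t] (+[1+ p ]) t _   = ℕ.m≤m+n (2 ℕ.+ t) (p ℕ.* (2 ℕ.+ t))
2+t≤∣s∣*[2+t] (-[1+ p ]) t _   = ℕ.m≤m+n (2 ℕ.+ t) (p ℕ.* (2 ℕ.+ t))

2≤∣s+1+r∣ : ∀ s t {r} → s ≢ 0ℤ → ∣ s ∣ ℕ.* (2 ℕ.+ t) ≤ r → 2 ≤ ∣ s - -[1+ r ] ∣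
2≤∣s+1+r∣ (+ zero)   t s≢0 _ = ⊥-elim (s≢0 refl)
2≤∣s+1+r∣ (+[1+ p ]) t {r} _ _ = s≤s (ℕ.≤-trans (s≤s z≤n) (ℕ.m≤n+m (suc r) p))
2≤∣s+1+r∣ (-[1+ p ]) t {r} _ j≤r =
  subst (λ d → 2 ≤ ∣ d ∣) (sym (⊖-≥ (s≤s p≤r))) (ℕ.m+n≤o⇒m≤o∸n 2 2+p≤r)
  where
  2+p≤r : 2 ℕ.+ p ≤ r
  2+p≤r = ℕ.≤-trans (ℕ.+-mono-≤ (ℕ.m≤m+n 2 t) (ℕ.m≤m*n p (2 ℕ.+ t))) j≤r
  p≤r : p ≤ r
  p≤r = ℕ.m+n≤o⇒n≤o 2 2+p≤r

prodℤ-replicate-1 : ∀ k → prodℤ (replicate k 1ℤ) ≡ 1ℤ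
prodℤ-replicate-1 zero    = refl
prodℤ-replicate-1 (suc k) = trans (*-identityˡ _) (prodℤ-replicate-1 k)

cyclic-padded : ∀ a k → CyclicSolution 1ℤ (a ∷ replicate k 1ℤ)
cyclic-padded a k zero =
  subst (λ p → a ∣ p - 1ℤ) (sym (prodℤ-replicate-1 k)) (∣ᵤ⇒∣ {a} {0ℤ} (∣ a ∣ ℕ.∣0))
cyclic-padded a k (suc i) =
  subst (_∣ x) (sym (lookup-replicate i 1ℤ)) (∣ᵤ⇒∣ {1ℤ} {x} (ℕ.1∣ ∣ x ∣))
  where x = a * prodExcept (replicate k 1ℤ) i - 1ℤ

chain : ℤ → (k : ℕ) → Vec ℤ (suc k)
chain a zero    = a ∷ []
chain a (suc k) = extend 1ℤ (chain a k)

cyclic-chain : ∀ a k → CyclicSolution 1ℤ (chain a k)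
cyclic-chain a zero    zero = ∣ᵤ⇒∣ {a} {0ℤ} (∣ a ∣ ℕ.∣0)
cyclic-chain a (suc k) = extend-cyclic 1ℤ (chain a k) (cyclic-chain a k)

lookup-chain-last : ∀ a k → lookup (chain a k) (fromℕ k) ≡ a
lookup-chain-last a zero    = refl
lookup-chain-last a (suc k) = lookup-chain-last a k

prodℤ-chain-cong : ∀ {s a b} → s ∣ a - b → ∀ k → s ∣ prodℤ (chain a k) - prodℤ (chain b k)
prodℤ-chain-cong {s} {a} {b} a≡b zero = subst (s ∣_) (sym (drop-1 a b)) a≡b
  where drop-1 : ∀ a b → a * 1ℤ - b * 1ℤ ≡ a - b
        drop-1 = solve-∀
prodℤ-chain-cong {s} a≡b (suc k) =
  subst (s ∣_) (sym (factor (prodℤ (chain _ k)) (prodℤ (chain _ k))))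
    (∣m⇒∣m*n _ (prodℤ-chain-cong a≡b k))
  where factor : ∀ x y → (1ℤ - x) * x - (1ℤ - y) * y ≡ (x - y) * (1ℤ - x - y)
        factor = solve-∀

prodℤ-chain-1 : ∀ k → prodℤ (chain -1ℤ k) ≡ - + sylProd k
prodℤ-chain-1 zero    = refl
prodℤ-chain-1 (suc k) = begin
  (1ℤ - p) * p                   ≡⟨ cong (λ p → (1ℤ - p) * p) (prodℤ-chain-1 k) ⟩
  (1ℤ - - + P) * (- + P)         ≡⟨ sylvester (+ P) ⟩
  - (+ P * (+ P + 1ℤ))           ≡⟨ cong -_ (sym (pos-* P (P ℕ.+ 1))) ⟩
  - + (P ℕ.* (P ℕ.+ 1))          ∎
  where
  p = prodℤ (chain -1ℤ k)
  P = sylProd k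
  sylvester : ∀ x → (1ℤ - - x) * (- x) ≡ - (x * (x + 1ℤ))
  sylvester = solve-∀

sylProd∣sylProd[n+m] : ∀ m n → sylProd m ℕ.∣ sylProd (n ℕ.+ m)
sylProd∣sylProd[n+m] m zero    = ℕ.∣-refl
sylProd∣sylProd[n+m] m (suc n) = ℕ.∣-trans (sylProd∣sylProd[n+m] m n) (ℕ.m∣m*n _)

prodℤ-chain-neg : ∀ j k → ∃[ r ] (j ≤ r × prodℤ (chain -[1+ j ] k) ≡ -[1+ r ])
prodℤ-chain-neg j zero    = j , ℕ.≤-refl , *-identityʳ -[1+ j ]
prodℤ-chain-neg j (suc k) with prodℤ-chain-neg j k
... | r , j≤r , p≡ = r ℕ.+ suc r ℕ.* suc r , ℕ.≤-trans j≤r (ℕ.m≤m+n r _) ,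
                     cong (λ p → (1ℤ - p) * p) p≡

2≤∣chain∣ : ∀ {j} → 1 ≤ j → ∀ k i → 2 ≤ ∣ lookup (chain -[1+ j ] k) i ∣
2≤∣chain∣ 1≤j zero    zero    = s≤s 1≤j
2≤∣chain∣ {j} 1≤j (suc k) zero with prodℤ-chain-neg j k
... | r , _ , p≡ = subst (λ p → 2 ≤ ∣ 1ℤ - p ∣) (sym p≡) (s≤s (s≤s z≤n))
2≤∣chain∣ 1≤j (suc k) (suc i) = 2≤∣chain∣ 1≤j k i

module _ (s : ℤ) {j : ℕ} (1≤j : 1 ≤ j) (seed≡-1 : s ∣ -[1+ j ] - -1ℤ)
         (far : ∀ {r} → j ≤ r → 2 ≤ ∣ s - -[1+ r ] ∣) where

  padded-solution : ∀ k → let q = extend s (-[1+ j ] ∷ replicate k 1ℤ) in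
                    IsSolution s q × TwoBig q × CoprimeToS s q
  padded-solution k = proj₁ solved , (zero , suc zero , (λ ()) , 2≤∣q₀∣ , s≤s 1≤j) , proj₂ solved
    where
    v : Vec ℤ (suc k)
    v = -[1+ j ] ∷ replicate k 1ℤ

    prod≡seed : prodℤ v ≡ -[1+ j ]
    prod≡seed = trans (cong (-[1+ j ] *_) (prodℤ-replicate-1 k)) (*-identityʳ _)

    2≤∣q₀∣ : 2 ≤ ∣ s - prodℤ v ∣
    2≤∣q₀∣ = subst (λ p → 2 ≤ ∣ s - p ∣) (sym prod≡seed) (far ℕ.≤-refl)

    nonzero : ∀ i → lookup (extend s v) i ≢ 0ℤ
    nonzero zero          = 2≤∣i∣⇒i≢0 2≤∣q₀∣
    nonzero (suc zero)    = 2≤∣i∣⇒i≢0 (s≤s 1≤j)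
    nonzero (suc (suc i)) = subst (_≢ 0ℤ) (sym (lookup-replicate i 1ℤ)) (λ ())

    unit : UnitMod s (prodℤ v)
    unit = subst (UnitMod s) (sym prod≡seed) (unitMod-cong seed≡-1 (unitMod-neg unitMod-1))

    solved : IsSolution s (extend s v) × CoprimeToS s (extend s v)
    solved = extend-solution s v (cyclic-padded _ k) unit nonzero

  chain-solution : ∀ k → UnitMod s (+ sylProd k) → let q = extend s (chain -[1+ j ] k) in
                   IsSolution s q × CoprimeToS s q × AllBig q
  chain-solution k unitSylProd = proj₁ solved , proj₂ solved , allBig
    where
    v : Vec ℤ (suc k)
    v = chain -[1+ j ] k

    unit : UnitMod s (prodℤ v)
    unit = unitMod-cong (prodℤ-chain-cong seed≡-1 k)
      (subst (UnitMod s) (sym (prodℤ-chain-1 k)) (unitMod-neg unitSylProd))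

    allBig : AllBig (extend s v)
    allBig zero with prodℤ-chain-neg j k
    ... | r , j≤r , p≡ = subst (λ p → 2 ≤ ∣ s - p ∣) (sym p≡) (far j≤r)
    allBig (suc i) = 2≤∣chain∣ 1≤j k i

    solved : IsSolution s (extend s v) × CoprimeToS s (extend s v)
    solved = extend-solution s v (cyclic-chain _ k) unit (λ i → 2≤∣i∣⇒i≢0 (allBig i))

module _ {s : ℤ} (s≢0 : s ≢ 0ℤ) where

  private
    -- A multiple of ∣ s ∣, so that -[1+ j t ] ≡ -1 (mod s), and at least t + 2 and ∣ s ∣ + 1,
    -- so that the seed is large and lies at distance ≥ 2 below s.
    j : ℕ → ℕ
    j t = ∣ s ∣ ℕ.* (2 ℕ.+ t)

    1≤j : ∀ t → 1 ≤ j t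
    1≤j t = ℕ.≤-trans (s≤s z≤n) (2+t≤∣s∣*[2+t] s t s≢0)

    t≤∣seed∣ : ∀ t → t ≤ ∣ -[1+ j t ] ∣
    t≤∣seed∣ t = ℕ.m≤n⇒m≤1+n (ℕ.m+n≤o⇒n≤o 2 (2+t≤∣s∣*[2+t] s t s≢0))

  infinitelyMany-twoBig : ∀ k → InfinitelyMany {2 ℕ.+ k} (λ q → IsSolution s q × TwoBig q × CoprimeToS s q)
  infinitelyMany-twoBig k = unbounded⇒fresh _ (λ q → ∣ lookup q (suc zero) ∣)
    (λ t → extend s (-[1+ j t ] ∷ replicate k 1ℤ))
    (λ t → padded-solution s (1≤j t) (-[1+∣s∣*m]≡-1[mod-s] s (2 ℕ.+ t)) (2≤∣s+1+r∣ s t s≢0) k) t≤∣seed∣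

  infinitelyMany-allBig : ∀ k → gcd s (+ sylProd (2 ℕ.+ k)) ≡ 1ℤ →
                          InfinitelyMany {2 ℕ.+ k} (λ q → IsSolution s q × CoprimeToS s q × AllBig q)
  infinitelyMany-allBig k gcd≡1 = unbounded⇒fresh _ (λ q → ∣ lookup q (fromℕ (suc k)) ∣)
    (λ t → extend s (chain -[1+ j t ] k))
    (λ t → chain-solution s (1≤j t) (-[1+∣s∣*m]≡-1[mod-s] s (2 ℕ.+ t)) (2≤∣s+1+r∣ s t s≢0) k unitSylProd)
    (λ t → subst (λ a → t ≤ ∣ a ∣) (sym (lookup-chain-last _ k)) (t≤∣seed∣ t))
    where
    unitSylProd : UnitMod s (+ sylProd k)
    unitSylProd = unitMod-divisor (∣ᵤ⇒∣ {+ sylProd k} {+ sylProd (2 ℕ.+ k)} (sylProd∣sylProd[n+m] k 2))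
                                  (gcd≡1⇒unitMod (trans (gcd-comm (+ sylProd (2 ℕ.+ k)) s) gcd≡1))

theorem1p2 :
      ((n : ℕ) → 2 ≤ n → (s : ℤ) → s ≢ 0ℤ →
        InfinitelyMany {n} (λ q → IsSolution s q × TwoBig q × CoprimeToS s q))
    × ((n : ℕ) → 2 ≤ n →
        ∃[ M ] (M ≡ + sylProd n
          × ((s : ℤ) → s ≢ 0ℤ → gcd s M ≡ 1ℤ →
              InfinitelyMany {n} (λ q → IsSolution s q × CoprimeToS s q × AllBig q))))
theorem1p2 =
    (λ { (suc (suc k)) (s≤s (s≤s _)) s s≢0 → infinitelyMany-twoBig s≢0 k })
  , (λ { (suc (suc k)) (s≤s (s≤s _)) →
         + sylProd (2 ℕ.+ k) , refl , λ s s≢0 → infinitelyMany-allBig s≢0 k })
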